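{- Let $(U,\Sigma)$ be an implicational base of a standard closure system $(U,\mathcal{F})$ with closure operator $\phi$, and let $c\in U$ be such that $c$ has at least one $D$-generator. Let $U_c=\{a\in U: c\notin\phi(\{a\})\}$ and let $(U_c,\Sigma_c)$ be the implicational base with $\Sigma_c=\Sigma_1\cup\Sigma_2$, where $$\Sigma_1=\{A\to b\in\Sigma: A\cup\{b\}\subseteq U_c\},\qquad \Sigma_2=\{A\to b: A\to x\in\Sigma,\ A\subseteq U_c,\ x\notin U_c,\ b\in U_c\setminus\phi^b(A)\}.$$ Then the $D$-generators of $c$ in $(U,\mathcal{F})$ are exactly the $D$-minimal keys of the closure system represented by $(U_c,\Sigma_c)$.
   Context: A closure system $(U,\mathcal{F})$ on a finite set $U$: $U\in\mathcal{F}$, closed under intersection; $\phi(A)=\bigcap\{F\in\mathcal{F}:A\subseteq F\}$. Standard: $\phi(\{a\})\setminus\{a\}\in\mathcal{F}$ for all $a$. An implicational base $(V,\Sigma)$ is a set of implications $A\to x$ ($A\subseteq V$, $x\in V$) representing the closure system on $V$ whose closed sets are the $F$ with ($A\subseteq F\Rightarrow x\in F$) for all $A\to x\in\Sigma$. For any closure operator $\psi$, $\psi^b(A)=\bigcup_{a\in A}\psi(\{a\})$. A minimal generator of $c$: $A$ with $c\in\phi(A)$, $c\notin\phi(A')$ for $A'\subsetneq A$. A $D$-generator of $c$: a minimal generator $A$ of $c$ with $c\notin\phi^b(A)$ such that every minimal generator $A'$ of $c$ with $A'\subseteq\phi^b(A)$ equals $A$. For a closure system on $V$ with closure operator $\psi$,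 a minimal key is an inclusion-minimal $K\subseteq V$ with $\psi(K)=V$; a minimal key $K$ is a $D$-minimal key if for every minimal key $K'$, $\psi^b(K')\subseteq\psi^b(K)$ implies $K'=K$. -}

module Defs where

open import Data.Nat using (ℕ)
open import Data.Fin using (Fin)
open import Data.Fin.Subset using (Subset; _∈_; _∉_; _⊂_; ⁅_⁆; ⊤)
open import Data.Product using (Σ; ∃; _×_; _,_)
open import Data.Sum using (_⊎_)
open import Data.List using (List)
import Data.List.Membership.Propositional as LM
open import Relation.Nullary using (¬_)
open import Relation.Binary.PropositionalEquality using (_≡_; _≢_)

Imps : ℕ → Set₁
Imps n = Subset n → Fin n → Set

Pred : ℕ → Set₁
Pred n = Fin n → Set

_⊆P_ : ∀ {n} → Subset n → Pred n → Set
F ⊆P V = ∀ {x} → x ∈ F → V x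

ClosedIn : ∀ {n} → Pred n → Imps n → Subset n → Set
ClosedIn V Imp F = (F ⊆P V) × (∀ A b → Imp A b → (∀ {x} → x ∈ A → x ∈ F) → b ∈ F)

Cl : ∀ {n} → Pred n → Imps n → Subset n → Pred n
Cl V Imp A x = ∀ F → ClosedIn V Imp F → (∀ {y} → y ∈ A → y ∈ F) → x ∈ F

ClB : ∀ {n} → Pred n → Imps n → Subset n → Pred n
ClB V Imp A x = ∃ λ a → a ∈ A × Cl V Imp ⁅ a ⁆ x

Base : ℕ → Set
Base n = List (Subset n × Fin n)

ListImp : ∀ {n} → Base n → Imps n
ListImp Σ' A b = LM._∈_ (A , b) Σ'

Full : ∀ {n} → Pred n
Full x = x ∈ ⊤

φ : ∀ {n} → Base n → Subset n → Pred n
φ Σ' = Cl Full (ListImp Σ')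

φb : ∀ {n} → Base n → Subset n → Pred n
φb Σ' = ClB Full (ListImp Σ')

-- Standard: φ({a}) \ {a} is closed for every a.
Standard : ∀ {n} → Base n → Set
Standard Σ' = ∀ a A b → ListImp Σ' A b →
  (∀ {x} → x ∈ A → φ Σ' ⁅ a ⁆ x × x ≢ a) → φ Σ' ⁅ a ⁆ b × b ≢ a

MinGen : ∀ {n} → Base n → Fin n → Subset n → Set
MinGen Σ' c A = φ Σ' A c × (∀ A' → A' ⊂ A → ¬ φ Σ' A' c)

DGen : ∀ {n} → Base n → Fin n → Subset n → Set
DGen Σ' c A = MinGen Σ' c A × ¬ φb Σ' A c ×
  (∀ A' → MinGen Σ' c A' → (∀ {x} → x ∈ A' → φb Σ' A x) → A' ≡ A)

Uc : ∀ {n} → Base n → Fin n → Pred n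
Uc Σ' c a = ¬ φ Σ' ⁅ a ⁆ c

Σc : ∀ {n} → Base n → Fin n → Imps n
Σc Σ' c A b =
  (ListImp Σ' A b × A ⊆P Uc Σ' c × Uc Σ' c b)
  ⊎ (∃ λ x → ListImp Σ' A x × A ⊆P Uc Σ' c × ¬ Uc Σ' c x
             × Uc Σ' c b × ¬ φb Σ' A b)

Spans : ∀ {n} → Pred n → Imps n → Subset n → Set
Spans V Imp K = ∀ x → (Cl V Imp K x → V x) × (V x → Cl V Imp K x)

MinKey : ∀ {n} → Pred n → Imps n → Subset n → Set
MinKey V Imp K = K ⊆P V × Spans V Imp K × (∀ K' → K' ⊂ K → ¬ Spans V Imp K')

DMinKey : ∀ {n} → Pred n → Imps n → Subset n → Set
DMinKey V Imp K = MinKey V Imp K ×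
  (∀ K' → MinKey V Imp K' → (∀ x → ClB V Imp K' x → ClB V Imp K x) → K' ≡ K)

-- Write ψ for the closure of (U_c, Σ_c). For a ∈ U_c, ψ({a}) = φ({a}): the set φ({a}) avoids c and
-- is therefore Σ_c-closed, while any Σ_c-closed F is closed under b ↦ φ({b}) because φ({b}) ∩ F is
-- Σ-closed. Hence ψ^b = φ^b on subsets of U_c. Moreover K ⊆ U_c is a key of (U_c, Σ_c) iff c ∈ φ(K):
-- if c ∉ φ(K), then φ(K) is Σ_c-closed and would contain a generator of c lying in U_c; if c ∈ φ(K),
-- a Σ_c-closed F ⊇ K is not Σ-closed, and the Σ₂-implications built from a violated implication of Σ
-- force F = U_c. So minimal keys are the minimal generators inside U_c, and since ψ^b = φ^b there,
-- the two D-conditions coincide.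
module Submission where

open import Defs
open import Data.Nat using (ℕ)
open import Data.Fin using (Fin)
open import Data.Fin.Properties using (any?)
open import Data.Fin.Subset using (Subset; _∈_; _∉_; _⊆_; ⁅_⁆)
open import Data.Fin.Subset.Properties using (_∈?_; _⊆?_; anySubset?; ∈⊤; x∈⁅x⁆; x∈⁅y⁆⇒x≡y)
open import Data.Vec using (tabulate)
open import Data.Vec.Properties using (lookup∘tabulate; lookup⇒[]=; []=⇒lookup)
open import Data.Empty using (⊥-elim)
open import Data.Sum using (inj₁; inj₂)
open import Data.Product using (∃; _×_; _,_; proj₁; proj₂)
open import Data.List.Relation.Unary.All as All using (all?)
open import Data.List.Relation.Unary.All.Properties using (¬All⇒Any¬)
import Data.List.Membership.Propositional as List
open import Function using (case_of_; _∘_)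
open import Relation.Nullary using (¬_; Dec; yes; no; does; contradiction)
open import Relation.Nullary.Decidable
  using (dec-true; dec-false; map′; decidable-stable; ¬?; _×-dec_; _→-dec_)
open import Relation.Binary.PropositionalEquality using (sym; trans; subst)

private
  variable
    n : ℕ

module _ {P : Pred n} (P? : ∀ x → Dec (P x)) where

  fromDec : Subset n
  fromDec = tabulate (λ x → does (P? x))

  ∈-fromDec⁺ : ∀ {x} → P x → x ∈ fromDec
  ∈-fromDec⁺ {x} px = lookup⇒[]= x fromDec (trans (lookup∘tabulate _ x) (dec-true (P? x) px))

  ∈-fromDec⁻ : ∀ {x} → x ∈ fromDec → P x
  ∈-fromDec⁻ {x} x∈ = decidable-stable (P? x) λ ¬px →
    case trans (sym (dec-false (P? x) ¬px)) (trans (sym (lookup∘tabulate _ x)) ([]=⇒lookup x∈))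
    of λ ()

⁅⁆⊆P : ∀ {P : Pred n} {x} → P x → ⁅ x ⁆ ⊆P P
⁅⁆⊆P {P = P} {x} px y∈⁅x⁆ = subst P (sym (x∈⁅y⁆⇒x≡y x y∈⁅x⁆)) px

module _ {V : Pred n} {Imp : Imps n} where

  Cl-extensive : ∀ {A x} → x ∈ A → Cl V Imp A x
  Cl-extensive x∈A F _ A⊆F = A⊆F x∈A

  Cl-trans : ∀ {A B x} → B ⊆P Cl V Imp A → Cl V Imp B x → Cl V Imp A x
  Cl-trans B⊆ClA x∈ClB F F-closed A⊆F = x∈ClB F F-closed (λ y∈B → B⊆ClA y∈B F F-closed A⊆F)

  Cl⁅⁆-trans : ∀ {a b x} → Cl V Imp ⁅ a ⁆ b → Cl V Imp ⁅ b ⁆ x → Cl V Imp ⁅ a ⁆ x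
  Cl⁅⁆-trans b∈Cla = Cl-trans (⁅⁆⊆P b∈Cla)

  implication⇒Cl : ∀ {A b} → Imp A b → Cl V Imp A b
  implication⇒Cl imp F F-closed A⊆F = proj₂ F-closed _ _ imp A⊆F

  ClB-extensive : ∀ {A x} → x ∈ A → ClB V Imp A x
  ClB-extensive {x = x} x∈A = x , x∈A , Cl-extensive (x∈⁅x⁆ x)

  ClB-trans : ∀ {A B x} → B ⊆P ClB V Imp A → ClB V Imp B x → ClB V Imp A x
  ClB-trans B⊆ClBA (b , b∈B , x∈Clb) =
    let a , a∈A , b∈Cla = B⊆ClBA b∈B in a , a∈A , Cl⁅⁆-trans b∈Cla x∈Clb

Respects : Subset n → Subset n × Fin n → Set
Respects F (A , b) = A ⊆ F → b ∈ F

Violates : Subset n → Subset n × Fin n → Set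
Violates F (A , b) = A ⊆ F × b ∉ F

respects? : ∀ F (i : Subset n × Fin n) → Dec (Respects F i)
respects? F (A , b) = (A ⊆? F) →-dec (b ∈? F)

¬Respects⇒Violates : ∀ F (i : Subset n × Fin n) → ¬ Respects F i → Violates F i
¬Respects⇒Violates F (A , b) ¬r =
  decidable-stable (A ⊆? F) (λ A⊈F → ¬r (⊥-elim ∘ A⊈F)) , λ b∈F → ¬r (λ _ → b∈F)

module _ (Σ' : Base n) where

  closed? : ∀ F → Dec (ClosedIn Full (ListImp Σ') F)
  closed? F = map′ (λ respected → (λ _ → ∈⊤) , λ A b → All.lookup respected)
                   (λ F-closed → All.tabulate λ {(A , b)} → proj₂ F-closed A b)
                   (all? (respects? F) Σ')

  ¬closed⇒violated : ∀ {F} → ¬ ClosedIn Full (ListImp Σ') F →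
                     ∃ λ i → i List.∈ Σ' × Violates F i
  ¬closed⇒violated {F} ¬closed with List.find (¬All⇒Any¬ (respects? F) Σ' (λ respected → ¬closed
    ((λ _ → ∈⊤) , λ A b → All.lookup respected)))
  ... | i , i∈Σ , ¬r = i , i∈Σ , ¬Respects⇒Violates F i ¬r

  φ? : ∀ A x → Dec (φ Σ' A x)
  φ? A x with anySubset? (λ F → closed? F ×-dec (A ⊆? F) ×-dec ¬? (x ∈? F))
  ... | yes (F , F-closed , A⊆F , x∉F) = no λ x∈φA → x∉F (x∈φA F F-closed A⊆F)
  ... | no ∄F = yes λ F F-closed A⊆F →
    decidable-stable (x ∈? F) λ x∉F → ∄F (F , F-closed , A⊆F , x∉F)

  φb? : ∀ A x → Dec (φb Σ' A x)
  φb? A x = any? λ a → (a ∈? A) ×-dec φ? ⁅ a ⁆ x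

  φ-set : Subset n → Subset n
  φ-set A = fromDec (φ? A)

  φ-set-closed : ∀ A → ClosedIn Full (ListImp Σ') (φ-set A)
  φ-set-closed A = (λ _ → ∈⊤) , λ B y imp B⊆φA →
    ∈-fromDec⁺ (φ? A) (Cl-trans (λ y∈B → ∈-fromDec⁻ (φ? A) (B⊆φA y∈B)) (implication⇒Cl imp))

  ⊆φ-set : ∀ A → A ⊆ φ-set A
  ⊆φ-set A x∈A = ∈-fromDec⁺ (φ? A) (Cl-extensive x∈A)

module Σc-Properties (Σ' : Base n) (c : Fin n) where

  private
    ψ : Subset n → Pred n
    ψ = Cl (Uc Σ' c) (Σc Σ' c)

    ψb : Subset n → Pred n
    ψb = ClB (Uc Σ' c) (Σc Σ' c)

  Uc? : ∀ a → Dec (Uc Σ' c a)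
  Uc? a = ¬? (φ? Σ' ⁅ a ⁆ c)

  c∉Uc : ¬ Uc Σ' c c
  c∉Uc c∉φc = c∉φc (Cl-extensive (x∈⁅x⁆ c))

  Uc-downward : ∀ {a y} → Uc Σ' c a → φ Σ' ⁅ a ⁆ y → Uc Σ' c y
  Uc-downward a∈Uc y∈φa c∈φy = a∈Uc (Cl⁅⁆-trans y∈φa c∈φy)

  φb-downward : ∀ {K y} → K ⊆P Uc Σ' c → φb Σ' K y → Uc Σ' c y
  φb-downward K⊆Uc (k , k∈K , y∈φk) = Uc-downward (K⊆Uc k∈K) y∈φk

  ⊆Uc⇒¬φb : ∀ {K} → K ⊆P Uc Σ' c → ¬ φb Σ' K c
  ⊆Uc⇒¬φb K⊆Uc (k , k∈K , c∈φk) = K⊆Uc k∈K c∈φk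

  ¬φb⇒⊆Uc : ∀ {K} → ¬ φb Σ' K c → K ⊆P Uc Σ' c
  ¬φb⇒⊆Uc c∉φbK k∈K c∈φk = c∉φbK (_ , k∈K , c∈φk)

  closed⇒Σc-closed : ∀ {F} → ClosedIn Full (ListImp Σ') F → c ∉ F → ClosedIn (Uc Σ' c) (Σc Σ' c) F
  closed⇒Σc-closed {F} F-closed c∉F = F⊆Uc , respects
    where
    F⊆Uc : F ⊆P Uc Σ' c
    F⊆Uc x∈F c∈φx = c∉F (c∈φx F F-closed (⁅⁆⊆P x∈F))

    respects : ∀ A b → Σc Σ' c A b → A ⊆ F → b ∈ F
    respects A b (inj₁ (imp , _)) A⊆F = proj₂ F-closed A b imp A⊆F
    respects A b (inj₂ (x , imp , _ , x∉Uc , _)) A⊆F =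
      contradiction (F⊆Uc (proj₂ F-closed A x imp A⊆F)) x∉Uc

  Uc-set-Σc-closed : ClosedIn (Uc Σ' c) (Σc Σ' c) (fromDec Uc?)
  Uc-set-Σc-closed = ∈-fromDec⁻ Uc? , λ where
    A b (inj₁ (_ , _ , b∈Uc)) _ → ∈-fromDec⁺ Uc? b∈Uc
    A b (inj₂ (_ , _ , _ , _ , b∈Uc , _)) _ → ∈-fromDec⁺ Uc? b∈Uc

  ψ⊆Uc : ∀ {K x} → K ⊆P Uc Σ' c → ψ K x → Uc Σ' c x
  ψ⊆Uc K⊆Uc x∈ψK = ∈-fromDec⁻ Uc? (x∈ψK _ Uc-set-Σc-closed (∈-fromDec⁺ Uc? ∘ K⊆Uc))

  -- φ({b}) ∩ F is Σ-closed: φ({b}) ⊆ U_c, so Σ-implications inside it are Σ₁-implications.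
  Σc-closed⇒φ⁅⁆⊆ : ∀ {F b} → ClosedIn (Uc Σ' c) (Σc Σ' c) F → b ∈ F → ∀ {x} → φ Σ' ⁅ b ⁆ x → x ∈ F
  Σc-closed⇒φ⁅⁆⊆ {F} {b} (F⊆Uc , F-respects) b∈F x∈φb = proj₂ (∈-fromDec⁻ G? (x∈φb _ G-closed ⁅b⁆⊆G))
    where
    G? : ∀ y → Dec (φ Σ' ⁅ b ⁆ y × y ∈ F)
    G? y = φ? Σ' ⁅ b ⁆ y ×-dec (y ∈? F)

    ⁅b⁆⊆G : ⁅ b ⁆ ⊆ fromDec G?
    ⁅b⁆⊆G = ⁅⁆⊆P (∈-fromDec⁺ G? (Cl-extensive (x∈⁅x⁆ b) , b∈F))

    G-closed : ClosedIn Full (ListImp Σ') (fromDec G?)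
    G-closed = (λ _ → ∈⊤) , λ B y imp B⊆G → ∈-fromDec⁺ G? (G-respects B y imp B⊆G)
      where
      G-respects : ∀ B y → ListImp Σ' B y → B ⊆ fromDec G? → φ Σ' ⁅ b ⁆ y × y ∈ F
      G-respects B y imp B⊆G = y∈φb , F-respects B y (inj₁ (imp , B⊆Uc , y∈Uc)) B⊆F
        where
        B⊆φb : B ⊆P φ Σ' ⁅ b ⁆
        B⊆φb z∈B = proj₁ (∈-fromDec⁻ G? (B⊆G z∈B))
        B⊆F : B ⊆ F
        B⊆F z∈B = proj₂ (∈-fromDec⁻ G? (B⊆G z∈B))
        y∈φb : φ Σ' ⁅ b ⁆ y
        y∈φb = Cl-trans B⊆φb (implication⇒Cl imp)
        B⊆Uc : B ⊆P Uc Σ' c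
        B⊆Uc z∈B = Uc-downward (F⊆Uc b∈F) (B⊆φb z∈B)
        y∈Uc : Uc Σ' c y
        y∈Uc = Uc-downward (F⊆Uc b∈F) y∈φb

  ψ⁅⁆⇒φ⁅⁆ : ∀ {a x} → Uc Σ' c a → ψ ⁅ a ⁆ x → φ Σ' ⁅ a ⁆ x
  ψ⁅⁆⇒φ⁅⁆ {a} a∈Uc x∈ψa = ∈-fromDec⁻ (φ? Σ' ⁅ a ⁆) (x∈ψa _ φa-Σc-closed (⊆φ-set Σ' ⁅ a ⁆))
    where
    φa-Σc-closed : ClosedIn (Uc Σ' c) (Σc Σ' c) (φ-set Σ' ⁅ a ⁆)
    φa-Σc-closed = closed⇒Σc-closed (φ-set-closed Σ' ⁅ a ⁆) (a∈Uc ∘ ∈-fromDec⁻ (φ? Σ' ⁅ a ⁆))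

  φ⁅⁆⇒ψ⁅⁆ : ∀ {a x} → φ Σ' ⁅ a ⁆ x → ψ ⁅ a ⁆ x
  φ⁅⁆⇒ψ⁅⁆ {a} x∈φa F F-closed ⁅a⁆⊆F = Σc-closed⇒φ⁅⁆⊆ F-closed (⁅a⁆⊆F (x∈⁅x⁆ a)) x∈φa

  ψb⇒φb : ∀ {K x} → K ⊆P Uc Σ' c → ψb K x → φb Σ' K x
  ψb⇒φb K⊆Uc (k , k∈K , x∈ψk) = k , k∈K , ψ⁅⁆⇒φ⁅⁆ (K⊆Uc k∈K) x∈ψk

  φb⇒ψb : ∀ {K x} → φb Σ' K x → ψb K x
  φb⇒ψb (k , k∈K , x∈φk) = k , k∈K , φ⁅⁆⇒ψ⁅⁆ x∈φk

  -- F ⊆ U_c cannot be Σ-closed, as it would contain c ∈ φ(K); a violated B → y has y ∉ U_c by Σ₁,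
  -- and then x ∈ F either through φ^b(B) or through the Σ₂-implication B → x.
  Σc-closed-⊇Uc : ∀ {K F x} → ClosedIn (Uc Σ' c) (Σc Σ' c) F → K ⊆ F → φ Σ' K c → Uc Σ' c x → x ∈ F
  Σc-closed-⊇Uc {K} {F} {x} F-Σc-closed@(F⊆Uc , F-respects) K⊆F c∈φK x∈Uc
    with ¬closed⇒violated Σ' (λ F-closed → c∉Uc (F⊆Uc (c∈φK F F-closed K⊆F)))
  ... | (B , y) , imp , B⊆F , y∉F with Uc? y | φb? Σ' B x
  ...   | yes y∈Uc | _ = contradiction (F-respects B y (inj₁ (imp , F⊆Uc ∘ B⊆F , y∈Uc)) B⊆F) y∉F
  ...   | no _ | yes (b , b∈B , x∈φb) = Σc-closed⇒φ⁅⁆⊆ F-Σc-closed (B⊆F b∈B) x∈φb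
  ...   | no y∉Uc | no x∉φbB = F-respects B x (inj₂ (y , imp , F⊆Uc ∘ B⊆F , y∉Uc , x∈Uc , x∉φbB)) B⊆F

  φ⇒Spans : ∀ {K} → K ⊆P Uc Σ' c → φ Σ' K c → Spans (Uc Σ' c) (Σc Σ' c) K
  φ⇒Spans K⊆Uc c∈φK x = ψ⊆Uc K⊆Uc , λ x∈Uc F F-closed K⊆F → Σc-closed-⊇Uc F-closed K⊆F c∈φK x∈Uc

  module _ {A₀} (A₀⊆Uc : A₀ ⊆P Uc Σ' c) (c∈φA₀ : φ Σ' A₀ c) where

    Spans⇒φ : ∀ {K} → Spans (Uc Σ' c) (Σc Σ' c) K → φ Σ' K c
    Spans⇒φ {K} K-spans = decidable-stable (φ? Σ' K c) λ c∉φK →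
      let φK-Σc-closed = closed⇒Σc-closed (φ-set-closed Σ' K) (c∉φK ∘ ∈-fromDec⁻ (φ? Σ' K))
          A₀⊆φK : A₀ ⊆P φ Σ' K
          A₀⊆φK a∈A₀ = ∈-fromDec⁻ (φ? Σ' K)
            (proj₂ (K-spans _) (A₀⊆Uc a∈A₀) _ φK-Σc-closed (⊆φ-set Σ' K))
      in c∉φK (Cl-trans A₀⊆φK c∈φA₀)

    MinGen⇒MinKey : ∀ {K} → K ⊆P Uc Σ' c → MinGen Σ' c K → MinKey (Uc Σ' c) (Σc Σ' c) K
    MinGen⇒MinKey K⊆Uc (c∈φK , K-minimal) =
      K⊆Uc , φ⇒Spans K⊆Uc c∈φK , λ K' K'⊂K K'-spans → K-minimal K' K'⊂K (Spans⇒φ K'-spans)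

    MinKey⇒MinGen : ∀ {K} → MinKey (Uc Σ' c) (Σc Σ' c) K → MinGen Σ' c K
    MinKey⇒MinGen (K⊆Uc , K-spans , K-minimal) =
      Spans⇒φ K-spans , λ K' K'⊂K@(K'⊆K , _) c∈φK' → K-minimal K' K'⊂K (φ⇒Spans (K⊆Uc ∘ K'⊆K) c∈φK')

    DGen⇒DMinKey : ∀ {A} → DGen Σ' c A → DMinKey (Uc Σ' c) (Σc Σ' c) A
    DGen⇒DMinKey {A} (A-gen , c∉φbA , A-unique) =
      MinGen⇒MinKey A⊆Uc A-gen , λ K K-key ψbK⊆ψbA →
        A-unique K (MinKey⇒MinGen K-key) λ k∈K → ψb⇒φb A⊆Uc (ψbK⊆ψbA _ (ClB-extensive k∈K))
      where
      A⊆Uc : A ⊆P Uc Σ' c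
      A⊆Uc = ¬φb⇒⊆Uc c∉φbA

    DMinKey⇒DGen : ∀ {K} → DMinKey (Uc Σ' c) (Σc Σ' c) K → DGen Σ' c K
    DMinKey⇒DGen (K-key@(K⊆Uc , _) , K-unique) =
      MinKey⇒MinGen K-key , ⊆Uc⇒¬φb K⊆Uc , λ A A-gen A⊆φbK →
        let A⊆Uc : A ⊆P Uc Σ' c
            A⊆Uc x∈A = φb-downward K⊆Uc (A⊆φbK x∈A)
        in K-unique A (MinGen⇒MinKey A⊆Uc A-gen) λ x x∈ψbA →
             φb⇒ψb (ClB-trans A⊆φbK (ψb⇒φb A⊆Uc x∈ψbA))

lemma5 : ∀ {n} (Σ' : Base n) (c : Fin n) → Standard Σ' → (∃ λ A → DGen Σ' c A) →
    ∀ (A : Subset n) → (DGen Σ' c A → DMinKey (Uc Σ' c) (Σc Σ' c) A)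
                     × (DMinKey (Uc Σ' c) (Σc Σ' c) A → DGen Σ' c A)
lemma5 Σ' c _ (A₀ , (c∈φA₀ , _) , c∉φbA₀ , _) A =
  DGen⇒DMinKey A₀⊆Uc c∈φA₀ , DMinKey⇒DGen A₀⊆Uc c∈φA₀
  where
  open Σc-Properties Σ' c
  A₀⊆Uc : A₀ ⊆P Uc Σ' c
  A₀⊆Uc = ¬φb⇒⊆Uc c∉φbA₀
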